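{- Let $S$ be a modal Kleene algebra whose test algebra $\mathrm{test}(S)$ is a complete lattice, and let $a,b\in S$. If $a+b$ is Noetherian and $a$ and $b$ locally d-commute, i.e. $\langle b|\,|a\rangle\le |a^*\rangle\,\langle b^*|$, then $a$ and $b$ d-commute, i.e. $\langle b^*|\,|a^*\rangle\le |a^*\rangle\,\langle b^*|$.
   Context: An idempotent semiring is a structure $(S,+,\cdot,0,1)$ such that $(S,+,0)$ is a commutative monoid with $a+a=a$, $(S,\cdot,1)$ is a monoid, multiplication distributes over addition from both sides, and $0a=a0=0$; natural order $a\le b\iff a+b=b$. A test is an element $p\le 1$ for which some $q$ satisfies $p+q=1$ and $pq=0=qp$; $q$ is unique, written $\neg p$; tests form a Boolean algebra $\mathrm{test}(S)$ (join $+$, meet $\cdot$); $p-q=p\cdot\neg q$. $S$ is a modal semiring if for each $a\in S$ there are maps $|a\rangle$ (forward diamond) and $\langle a|$ (backward diamond) on $\mathrm{test}(S)$ with, for all $a,b,p,q$: $|a\rangle p\le q\iff \neg q\,a\,p\le 0$; $\langle a|p\le q\iff p\,a\,\neg q\le 0$; $|ab\rangle p=|a\rangle(|b\rangle p)$; $\langle ab|p=\langle b|(\langle a|p)$. Maps on tests are ordered pointwise; juxtaposition denotes composition. A Kleene algebra is an idempotent semiring with ${}^*$ such that $1+aa^*\le a^*$, $b+ac\le c\Rightarrow a^*b\le c$, $1+a^*a\le a^*$, $b+ca\le c\Rightarrow ba^*\le c$. A modal Kleene algebra is a Kleene algebra that is a modal semiring. An element $c$ is Noetherian if for all tests $p$,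 $p-|c\rangle p\le 0$ implies $p\le 0$. -}

module Defs where

open import Level using (Level; suc; _⊔_)
open import Data.Product using (Σ; Σ-syntax; _×_; proj₁; proj₂)
open import Relation.Binary.PropositionalEquality using (_≡_)
open import Function.Bundles using (_⇔_)

record KleeneAlgebra (c : Level) : Set (suc c) where
  infixl 6 _+_
  infixl 7 _·_
  infix 4 _≤_
  field
    Carrier : Set c
    _+_ _·_ : Carrier → Carrier → Carrier
    𝟘 𝟙 : Carrier
    _⋆ : Carrier → Carrier
    +-assoc : ∀ x y z → (x + y) + z ≡ x + (y + z)
    +-comm : ∀ x y → x + y ≡ y + x
    +-identityˡ : ∀ x → 𝟘 + x ≡ x
    +-idem : ∀ x → x + x ≡ x
    ·-assoc : ∀ x y z → (x · y) · z ≡ x · (y · z)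
    ·-identityˡ : ∀ x → 𝟙 · x ≡ x
    ·-identityʳ : ∀ x → x · 𝟙 ≡ x
    distribˡ : ∀ x y z → x · (y + z) ≡ x · y + x · z
    distribʳ : ∀ x y z → (y + z) · x ≡ y · x + z · x
    zeroˡ : ∀ x → 𝟘 · x ≡ 𝟘
    zeroʳ : ∀ x → x · 𝟘 ≡ 𝟘

  _≤_ : Carrier → Carrier → Set c
  x ≤ y = x + y ≡ y

  field
    ⋆-unfoldˡ : ∀ a → 𝟙 + a · (a ⋆) ≤ a ⋆
    ⋆-inductˡ : ∀ a b c → b + a · c ≤ c → (a ⋆) · b ≤ c
    ⋆-unfoldʳ : ∀ a → 𝟙 + (a ⋆) · a ≤ a ⋆
    ⋆-inductʳ : ∀ a b c → b + c · a ≤ c → b · (a ⋆) ≤ c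

  IsTest : Carrier → Set c
  IsTest p = p ≤ 𝟙 × Σ[ q ∈ Carrier ] (p + q ≡ 𝟙 × p · q ≡ 𝟘 × q · p ≡ 𝟘)

  Test : Set c
  Test = Σ Carrier IsTest

  neg : Test → Carrier
  neg p = proj₁ (proj₂ (proj₂ p))

  _≤ₜ_ : Test → Test → Set c
  p ≤ₜ q = proj₁ p ≤ proj₁ q

  _-ₜ_ : Test → Test → Carrier
  p -ₜ q = proj₁ p · neg q

record ModalKleeneAlgebra (c : Level) : Set (suc c) where
  field
    KA : KleeneAlgebra c
  open KleeneAlgebra KA public
  field
    fdia : Carrier → Test → Test
    bdia : Carrier → Test → Test
    fdia-adj : ∀ a p q → (fdia a p ≤ₜ q) ⇔ (neg q · a · proj₁ p ≤ 𝟘)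
    bdia-adj : ∀ a p q → (bdia a p ≤ₜ q) ⇔ (proj₁ p · a · neg q ≤ 𝟘)
    fdia-comp : ∀ a b p → proj₁ (fdia (a · b) p) ≡ proj₁ (fdia a (fdia b p))
    bdia-comp : ∀ a b p → proj₁ (bdia (a · b) p) ≡ proj₁ (bdia b (bdia a p))

module _ {c : Level} (S : ModalKleeneAlgebra c) where
  open ModalKleeneAlgebra S

  TestsComplete : Set (suc c)
  TestsComplete = (P : Test → Set c) →
    Σ[ s ∈ Test ] ((∀ p → P p → p ≤ₜ s) × (∀ u → (∀ p → P p → p ≤ₜ u) → s ≤ₜ u))

  Noetherian : Carrier → Set c
  Noetherian x = ∀ p → (p -ₜ fdia x p) ≤ 𝟘 → proj₁ p ≤ 𝟘

  LocallyDCommute : Carrier → Carrier → Set c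
  LocallyDCommute a b = ∀ p → bdia b (fdia a p) ≤ₜ fdia (a ⋆) (bdia (b ⋆) p)

  DCommute : Carrier → Carrier → Set c
  DCommute a b = ∀ p → bdia (b ⋆) (fdia (a ⋆) p) ≤ₜ fdia (a ⋆) (bdia (b ⋆) p)

module Submission where

-- Write A = a⋆ and B = b⋆, and call a test q *admissible* when
--   ⟨B| (q ⊓ |A⟩p) ≤ |A⟩ ⟨B| p   for every test p,
-- i.e. when d-commutation holds on the part of the state space where q holds.
-- Since test(S) is complete we may take the join R of all admissible tests.
--   (1) Admissibility is closed under joins, so R is admissible: by
--       conjugation, "q is admissible" says that q lies below a family of
--       tests that does not depend on q.
--   (2) If q·a·¬r ≤ 0 and q·b·¬r ≤ 0 for an admissible r, then q is
--       admissible: unfold B once, split on p, and use local d-commutation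
--       together with the admissibility of r on the a-successors.
--   (3) Applied to r = R and q = ¬|a+b⟩¬R, step (2) gives q ≤ R, i.e.
--       ¬R - |a+b⟩¬R ≤ 0, so ¬R = 0 because a+b is Noetherian; hence R = 1
--       and admissibility of R is d-commutation.

open import Defs
open import Level using (Level)
open import Data.Product using (_,_; proj₁; proj₂)
open import Function.Bundles using (Equivalence)
open import Relation.Binary.Bundles using (Poset)
open import Relation.Binary.PropositionalEquality
  using (_≡_; refl; sym; trans; cong; subst; isEquivalence; module ≡-Reasoning)
import Relation.Binary.Reasoning.PartialOrder as PosetReasoning

module KleeneFacts {c : Level} (K : KleeneAlgebra c) where
  open KleeneAlgebra K

  ≤-refl : ∀ {x} → x ≤ x
  ≤-refl {x} = +-idem x

  ≤-reflexive : ∀ {x y} → x ≡ y → x ≤ y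
  ≤-reflexive refl = ≤-refl

  ≤-trans : ∀ {x y z} → x ≤ y → y ≤ z → x ≤ z
  ≤-trans {x} {y} {z} x≤y y≤z = begin
    x + z        ≡⟨ cong (x +_) (sym y≤z) ⟩
    x + (y + z)  ≡⟨ sym (+-assoc x y z) ⟩
    (x + y) + z  ≡⟨ cong (_+ z) x≤y ⟩
    y + z        ≡⟨ y≤z ⟩
    z            ∎
    where open ≡-Reasoning

  ≤-antisym : ∀ {x y} → x ≤ y → y ≤ x → x ≡ y
  ≤-antisym {x} {y} x≤y y≤x = trans (sym y≤x) (trans (+-comm y x) x≤y)

  ≤-poset : Poset c c c
  ≤-poset = record
    { _≈_ = _≡_
    ; _≤_ = _≤_
    ; isPartialOrder = record
      { isPreorder = record
        { isEquivalence = isEquivalence ; reflexive = ≤-reflexive ; trans = ≤-trans }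
      ; antisym = ≤-antisym
      }
    }

  +-identityʳ : ∀ x → x + 𝟘 ≡ x
  +-identityʳ x = trans (+-comm x 𝟘) (+-identityˡ x)

  +-lub : ∀ {x y z} → x ≤ z → y ≤ z → x + y ≤ z
  +-lub {x} {y} {z} x≤z y≤z = trans (+-assoc x y z) (trans (cong (x +_) y≤z) x≤z)

  +-ub₁ : ∀ {x y} → x ≤ x + y
  +-ub₁ {x} {y} = trans (sym (+-assoc x x y)) (cong (_+ y) (+-idem x))

  +-ub₂ : ∀ {x y} → y ≤ x + y
  +-ub₂ {x} {y} = subst (y ≤_) (+-comm y x) +-ub₁

  ·-monoˡ : ∀ {x y} z → x ≤ y → z · x ≤ z · y
  ·-monoˡ {x} {y} z x≤y = trans (sym (distribˡ z x y)) (cong (z ·_) x≤y)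

  ·-monoʳ : ∀ {x y} z → x ≤ y → x · z ≤ y · z
  ·-monoʳ {x} {y} z x≤y = trans (sym (distribʳ z x y)) (cong (_· z) x≤y)

  ·-mono : ∀ {x x′ y y′} → x ≤ x′ → y ≤ y′ → x · y ≤ x′ · y′
  ·-mono {x′ = x′} {y = y} x≤x′ y≤y′ = ≤-trans (·-monoʳ y x≤x′) (·-monoˡ x′ y≤y′)

  ·-decreasingʳ : ∀ x {y} → y ≤ 𝟙 → x · y ≤ x
  ·-decreasingʳ x y≤1 = ≤-trans (·-monoˡ x y≤1) (≤-reflexive (·-identityʳ x))

  ·-decreasingˡ : ∀ {x} y → x ≤ 𝟙 → x · y ≤ y
  ·-decreasingˡ y x≤1 = ≤-trans (·-monoʳ y x≤1) (≤-reflexive (·-identityˡ y))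

  null-≡ : ∀ {x} → x ≤ 𝟘 → x ≡ 𝟘
  null-≡ {x} x≤0 = trans (sym (+-identityʳ x)) x≤0

  +-null : ∀ {u v} → v ≤ 𝟘 → u + v ≡ u
  +-null {u} v≤0 = trans (cong (u +_) (null-≡ v≤0)) (+-identityʳ u)

  null-·ˡ : ∀ {x} y → x ≤ 𝟘 → x · y ≤ 𝟘
  null-·ˡ y x≤0 = ≤-trans (·-monoʳ y x≤0) (≤-reflexive (zeroˡ y))

  null-·ʳ : ∀ {x} y → x ≤ 𝟘 → y · x ≤ 𝟘
  null-·ʳ y x≤0 = ≤-trans (·-monoˡ y x≤0) (≤-reflexive (zeroʳ y))

  null-assocʳ : ∀ {x y z} → x · y · z ≤ 𝟘 → x · (y · z) ≤ 𝟘
  null-assocʳ {x} {y} {z} = subst (_≤ 𝟘) (·-assoc x y z)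

  null-assocˡ : ∀ {x y z} → x · (y · z) ≤ 𝟘 → x · y · z ≤ 𝟘
  null-assocˡ {x} {y} {z} = subst (_≤ 𝟘) (sym (·-assoc x y z))

  ⋆-refl : ∀ a → 𝟙 ≤ a ⋆
  ⋆-refl a = ≤-trans +-ub₁ (⋆-unfoldˡ a)

  ⋆-step : ∀ a → a · a ⋆ ≤ a ⋆
  ⋆-step a = ≤-trans +-ub₂ (⋆-unfoldˡ a)

  ⋆-trans : ∀ a → a ⋆ · a ⋆ ≤ a ⋆
  ⋆-trans a = ⋆-inductˡ a (a ⋆) (a ⋆) (+-lub ≤-refl (⋆-step a))

  ⋆-unfoldˡ-≥ : ∀ a → a ⋆ ≤ 𝟙 + a · a ⋆
  ⋆-unfoldˡ-≥ a =
    subst (_≤ 𝟙 + a · a ⋆) (·-identityʳ (a ⋆))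
      (⋆-inductˡ a 𝟙 (𝟙 + a · a ⋆) (+-lub +-ub₁ (≤-trans a·unfold≤ +-ub₂)))
    where
    a·unfold≤ : a · (𝟙 + a · a ⋆) ≤ a · a ⋆
    a·unfold≤ = subst (_≤ a · a ⋆) (sym (distribˡ a 𝟙 (a · a ⋆)))
      (+-lub (·-monoˡ a (⋆-refl a)) (·-monoˡ a (⋆-step a)))

  ⋆-null : ∀ u a v → u · v ≤ 𝟘 → u · (a · a ⋆) · v ≤ 𝟘 → u · a ⋆ · v ≤ 𝟘
  ⋆-null u a v uv≤0 uaa⋆v≤0 = ≤-trans (·-monoʳ v (·-monoˡ u (⋆-unfoldˡ-≥ a)))
    (subst (_≤ 𝟘) (sym expand) (+-lub uv≤0 uaa⋆v≤0))
    where
    open ≡-Reasoning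
    expand : u · (𝟙 + a · a ⋆) · v ≡ u · v + u · (a · a ⋆) · v
    expand = begin
      u · (𝟙 + a · a ⋆) · v              ≡⟨ cong (_· v) (distribˡ u 𝟙 (a · a ⋆)) ⟩
      (u · 𝟙 + u · (a · a ⋆)) · v        ≡⟨ cong (λ w → (w + u · (a · a ⋆)) · v) (·-identityʳ u) ⟩
      (u + u · (a · a ⋆)) · v            ≡⟨ distribʳ v u (u · (a · a ⋆)) ⟩
      u · v + u · (a · a ⋆) · v          ∎

  ⌜_⌝ : Test → Carrier
  ⌜ t ⌝ = proj₁ t

  test-≤𝟙 : ∀ t → ⌜ t ⌝ ≤ 𝟙
  test-≤𝟙 t = proj₁ (proj₂ t)

  test-+-neg : ∀ t → ⌜ t ⌝ + neg t ≡ 𝟙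
  test-+-neg t = proj₁ (proj₂ (proj₂ (proj₂ t)))

  test-·-neg : ∀ t → ⌜ t ⌝ · neg t ≡ 𝟘
  test-·-neg t = proj₁ (proj₂ (proj₂ (proj₂ (proj₂ t))))

  neg-·-test : ∀ t → neg t · ⌜ t ⌝ ≡ 𝟘
  neg-·-test t = proj₂ (proj₂ (proj₂ (proj₂ (proj₂ t))))

  neg-≤𝟙 : ∀ t → neg t ≤ 𝟙
  neg-≤𝟙 t = ≤-trans +-ub₂ (≤-reflexive (test-+-neg t))

  ∁ : Test → Test
  ∁ t = neg t , neg-≤𝟙 t , ⌜ t ⌝ , trans (+-comm (neg t) ⌜ t ⌝) (test-+-neg t) ,
        neg-·-test t , test-·-neg t

  test-split : ∀ t x → x ≡ ⌜ t ⌝ · x + neg t · x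
  test-split t x = begin
    x                          ≡⟨ sym (·-identityˡ x) ⟩
    𝟙 · x                      ≡⟨ cong (_· x) (sym (test-+-neg t)) ⟩
    (⌜ t ⌝ + neg t) · x        ≡⟨ distribʳ x ⌜ t ⌝ (neg t) ⟩
    ⌜ t ⌝ · x + neg t · x      ∎
    where open ≡-Reasoning

  split-null : ∀ t u v → u · ⌜ t ⌝ · v ≤ 𝟘 → u · neg t · v ≤ 𝟘 → u · v ≤ 𝟘
  split-null t u v ut≤0 u¬t≤0 =
    subst (_≤ 𝟘) (sym (cong (u ·_) (test-split t v)))
      (subst (_≤ 𝟘) (sym (distribˡ u (⌜ t ⌝ · v) (neg t · v)))
        (+-lub (null-assocʳ ut≤0) (null-assocʳ u¬t≤0)))

  below-test : ∀ {x} t → x ≤ 𝟙 → neg t · x ≤ 𝟘 → x ≤ ⌜ t ⌝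
  below-test {x} t x≤1 ¬tx≤0 =
    subst (_≤ ⌜ t ⌝) (sym (trans (test-split t x) (+-null ¬tx≤0))) (·-decreasingʳ ⌜ t ⌝ x≤1)

  test-splitʳ : ∀ t x → x ≡ x · ⌜ t ⌝ + x · neg t
  test-splitʳ t x = begin
    x                          ≡⟨ sym (·-identityʳ x) ⟩
    x · 𝟙                      ≡⟨ cong (x ·_) (sym (test-+-neg t)) ⟩
    x · (⌜ t ⌝ + neg t)        ≡⟨ distribˡ x ⌜ t ⌝ (neg t) ⟩
    x · ⌜ t ⌝ + x · neg t      ∎
    where open ≡-Reasoning

  test-idem : ∀ t → ⌜ t ⌝ · ⌜ t ⌝ ≡ ⌜ t ⌝
  test-idem t = sym (trans (test-splitʳ t ⌜ t ⌝) (+-null (≤-reflexive (test-·-neg t))))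

  test-comm : ∀ s t → ⌜ s ⌝ · ⌜ t ⌝ ≡ ⌜ t ⌝ · ⌜ s ⌝
  test-comm s t = trans st≡sts (sym ts≡sts)
    where
    st≡sts : ⌜ s ⌝ · ⌜ t ⌝ ≡ ⌜ s ⌝ · ⌜ t ⌝ · ⌜ s ⌝
    st≡sts = trans (test-splitʳ s (⌜ s ⌝ · ⌜ t ⌝)) (+-null (≤-trans
      (·-monoʳ (neg s) (·-decreasingʳ ⌜ s ⌝ (test-≤𝟙 t))) (≤-reflexive (test-·-neg s))))
    ts≡sts : ⌜ t ⌝ · ⌜ s ⌝ ≡ ⌜ s ⌝ · ⌜ t ⌝ · ⌜ s ⌝
    ts≡sts = trans (test-split s (⌜ t ⌝ · ⌜ s ⌝)) (trans (+-null (≤-trans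
      (·-monoˡ (neg s) (·-decreasingˡ ⌜ s ⌝ (test-≤𝟙 t))) (≤-reflexive (neg-·-test s))))
      (sym (·-assoc ⌜ s ⌝ ⌜ t ⌝ ⌜ s ⌝)))

  infixl 7 _⊓_
  _⊓_ : Test → Test → Test
  s ⊓ t = ⌜ s ⌝ · ⌜ t ⌝ , st≤1 , neg s + neg t ,
          ≤-antisym (+-lub st≤1 (+-lub (neg-≤𝟙 s) (neg-≤𝟙 t))) 1≤ ,
          null-≡ st¬≤0 , null-≡ ¬st≤0
    where
    st≤1 : ⌜ s ⌝ · ⌜ t ⌝ ≤ 𝟙
    st≤1 = ≤-trans (·-decreasingʳ ⌜ s ⌝ (test-≤𝟙 t)) (test-≤𝟙 s)
    -- 1 = s + ¬s = (s·t + s·¬t) + ¬s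
    1≤ : 𝟙 ≤ ⌜ s ⌝ · ⌜ t ⌝ + (neg s + neg t)
    1≤ = subst (_≤ ⌜ s ⌝ · ⌜ t ⌝ + (neg s + neg t))
      (trans (cong (_+ neg s) (sym (test-splitʳ t ⌜ s ⌝))) (test-+-neg s))
      (+-lub (+-lub +-ub₁ (≤-trans (·-decreasingˡ (neg t) (test-≤𝟙 s)) (≤-trans +-ub₂ +-ub₂)))
             (≤-trans +-ub₁ +-ub₂))
    st¬≤0 : ⌜ s ⌝ · ⌜ t ⌝ · (neg s + neg t) ≤ 𝟘
    st¬≤0 = subst (_≤ 𝟘) (sym (distribˡ (⌜ s ⌝ · ⌜ t ⌝) (neg s) (neg t))) (+-lub
      (subst (_≤ 𝟘) (cong (_· neg s) (test-comm t s))
        (null-assocˡ (null-·ʳ ⌜ t ⌝ (≤-reflexive (test-·-neg s)))))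
      (null-assocˡ (null-·ʳ ⌜ s ⌝ (≤-reflexive (test-·-neg t)))))
    ¬st≤0 : (neg s + neg t) · (⌜ s ⌝ · ⌜ t ⌝) ≤ 𝟘
    ¬st≤0 = subst (_≤ 𝟘) (sym (distribʳ (⌜ s ⌝ · ⌜ t ⌝) (neg s) (neg t))) (+-lub
      (null-assocʳ (null-·ˡ ⌜ t ⌝ (≤-reflexive (neg-·-test s))))
      (subst (_≤ 𝟘) (cong (neg t ·_) (test-comm t s))
        (null-assocʳ (null-·ˡ ⌜ s ⌝ (≤-reflexive (neg-·-test t))))))

  ⊓-lowerˡ : ∀ s t → (s ⊓ t) ≤ₜ s
  ⊓-lowerˡ s t = ·-decreasingʳ ⌜ s ⌝ (test-≤𝟙 t)

  ⊓-lowerʳ : ∀ s t → (s ⊓ t) ≤ₜ t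
  ⊓-lowerʳ s t = ·-decreasingˡ ⌜ t ⌝ (test-≤𝟙 s)

  ⊓-greatest : ∀ t {u v} → ⌜ t ⌝ ≤ u → ⌜ t ⌝ ≤ v → ⌜ t ⌝ ≤ u · v
  ⊓-greatest t {u} {v} t≤u t≤v = subst (_≤ u · v) (test-idem t) (·-mono t≤u t≤v)

module DiamondFacts {c : Level} (S : ModalKleeneAlgebra c) where
  open ModalKleeneAlgebra S
  open KleeneFacts KA public

  fdia-intro : ∀ a p q → neg q · a · ⌜ p ⌝ ≤ 𝟘 → fdia a p ≤ₜ q
  fdia-intro a p q = Equivalence.from (fdia-adj a p q)

  fdia-elim : ∀ a p q → fdia a p ≤ₜ q → neg q · a · ⌜ p ⌝ ≤ 𝟘
  fdia-elim a p q = Equivalence.to (fdia-adj a p q)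

  bdia-intro : ∀ a p q → ⌜ p ⌝ · a · neg q ≤ 𝟘 → bdia a p ≤ₜ q
  bdia-intro a p q = Equivalence.from (bdia-adj a p q)

  bdia-elim : ∀ a p q → bdia a p ≤ₜ q → ⌜ p ⌝ · a · neg q ≤ 𝟘
  bdia-elim a p q = Equivalence.to (bdia-adj a p q)

  fdia-unit : ∀ a p → neg (fdia a p) · a · ⌜ p ⌝ ≤ 𝟘
  fdia-unit a p = fdia-elim a p (fdia a p) ≤-refl

  bdia-unit : ∀ a p → ⌜ p ⌝ · a · neg (bdia a p) ≤ 𝟘
  bdia-unit a p = bdia-elim a p (bdia a p) ≤-refl

  fdia-null : ∀ x a p → ⌜ x ⌝ · a · ⌜ p ⌝ ≤ 𝟘 → ⌜ x ⌝ · ⌜ fdia a p ⌝ ≤ 𝟘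
  fdia-null x a p xap≤0 =
    ≤-trans (·-monoˡ ⌜ x ⌝ (fdia-intro a p (∁ x) xap≤0)) (≤-reflexive (test-·-neg x))

  fdia-null⁻ : ∀ z a p → z · ⌜ fdia a p ⌝ ≤ 𝟘 → z · a · ⌜ p ⌝ ≤ 𝟘
  fdia-null⁻ z a p zd≤0 = null-assocˡ (split-null (fdia a p) z (a · ⌜ p ⌝)
    (null-·ˡ (a · ⌜ p ⌝) zd≤0)
    (null-assocˡ (null-·ʳ z (null-assocʳ (fdia-unit a p)))))

  fdia-mono : ∀ a {p p′} → p ≤ₜ p′ → fdia a p ≤ₜ fdia a p′
  fdia-mono a {p} {p′} p≤p′ = fdia-intro a p (fdia a p′)
    (≤-trans (·-monoˡ (neg (fdia a p′) · a) p≤p′) (fdia-unit a p′))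

  fdia-monoᵉ : ∀ {a a′} p → a ≤ a′ → fdia a p ≤ₜ fdia a′ p
  fdia-monoᵉ {a} {a′} p a≤a′ = fdia-intro a p (fdia a′ p)
    (≤-trans (·-monoʳ ⌜ p ⌝ (·-monoˡ (neg (fdia a′ p)) a≤a′)) (fdia-unit a′ p))

  bdia-mono : ∀ a {p p′} → p ≤ₜ p′ → bdia a p ≤ₜ bdia a p′
  bdia-mono a {p} {p′} p≤p′ = bdia-intro a p (bdia a p′)
    (≤-trans (·-monoʳ (neg (bdia a p′)) (·-monoʳ a p≤p′)) (bdia-unit a p′))

  bdia-monoᵉ : ∀ {a a′} p → a ≤ a′ → bdia a p ≤ₜ bdia a′ p
  bdia-monoᵉ {a} {a′} p a≤a′ = bdia-intro a p (bdia a′ p)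
    (≤-trans (·-monoʳ (neg (bdia a′ p)) (·-monoˡ ⌜ p ⌝ a≤a′)) (bdia-unit a′ p))

  -- Conjugation: ⟨a|s ≤ t iff s ⊓ |a⟩¬t = 0.  It turns an upper bound on
  -- ⟨a|s into a lower bound on the complement of s.
  bdia-conj-elim : ∀ a s t → bdia a s ≤ₜ t → ⌜ s ⌝ · ⌜ fdia a (∁ t) ⌝ ≤ 𝟘
  bdia-conj-elim a s t ⟨a|s≤t = fdia-null s a (∁ t) (bdia-elim a s t ⟨a|s≤t)

  bdia-conj-intro : ∀ a s t → ⌜ s ⌝ · ⌜ fdia a (∁ t) ⌝ ≤ 𝟘 → bdia a s ≤ₜ t
  bdia-conj-intro a s t s⊓d≤0 = bdia-intro a s t (fdia-null⁻ ⌜ s ⌝ a (∁ t) s⊓d≤0)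

  fdia-summand : ∀ {x y} p → x ≤ y → neg (fdia y p) · x · ⌜ p ⌝ ≤ 𝟘
  fdia-summand {x} {y} p x≤y = fdia-null⁻ (neg (fdia y p)) x p
    (≤-trans (·-monoˡ (neg (fdia y p)) (fdia-monoᵉ p x≤y)) (≤-reflexive (neg-·-test (fdia y p))))

  fdia-guard : ∀ x a r p → ⌜ x ⌝ · a · neg r ≤ 𝟘 → (x ⊓ fdia a p) ≤ₜ fdia a (r ⊓ p)
  fdia-guard x a r p xa¬r≤0 = below-test V (test-≤𝟙 (x ⊓ fdia a p))
    (null-assocʳ (fdia-null (∁ V ⊓ x) a p (split-null r (neg V · ⌜ x ⌝ · a) ⌜ p ⌝ on-r off-r)))
    where
    V = fdia a (r ⊓ p)
    on-r : neg V · ⌜ x ⌝ · a · ⌜ r ⌝ · ⌜ p ⌝ ≤ 𝟘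
    on-r = ≤-trans (·-monoʳ ⌜ p ⌝ (·-monoʳ ⌜ r ⌝ (·-monoʳ a (·-decreasingʳ (neg V) (test-≤𝟙 x)))))
      (null-assocˡ (fdia-unit a (r ⊓ p)))
    off-r : neg V · ⌜ x ⌝ · a · neg r · ⌜ p ⌝ ≤ 𝟘
    off-r = ≤-trans (·-monoʳ ⌜ p ⌝ (·-monoʳ (neg r) (·-monoʳ a (·-decreasingˡ ⌜ x ⌝ (neg-≤𝟙 V)))))
      (null-·ˡ ⌜ p ⌝ xa¬r≤0)

  fdia-⋆-inflate : ∀ a p → p ≤ₜ fdia (a ⋆) p
  fdia-⋆-inflate a p = below-test (fdia (a ⋆) p) (test-≤𝟙 p)
    (≤-trans (·-monoˡ (neg (fdia (a ⋆) p)) p≤a⋆p) (null-assocʳ (fdia-unit (a ⋆) p)))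
    where
    p≤a⋆p : ⌜ p ⌝ ≤ a ⋆ · ⌜ p ⌝
    p≤a⋆p = subst (_≤ a ⋆ · ⌜ p ⌝) (·-identityˡ ⌜ p ⌝) (·-monoʳ ⌜ p ⌝ (⋆-refl a))

  bdia-⋆-inflate : ∀ b p → p ≤ₜ bdia (b ⋆) p
  bdia-⋆-inflate b p = below-test G (test-≤𝟙 p)
    (subst (_≤ 𝟘) (test-comm p (∁ G)) (≤-trans (·-monoʳ (neg G) p≤pb⋆) (bdia-unit (b ⋆) p)))
    where
    G = bdia (b ⋆) p
    p≤pb⋆ : ⌜ p ⌝ ≤ ⌜ p ⌝ · b ⋆
    p≤pb⋆ = subst (_≤ ⌜ p ⌝ · b ⋆) (·-identityʳ ⌜ p ⌝) (·-monoˡ ⌜ p ⌝ (⋆-refl b))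

  fdia-⋆-idem : ∀ a p → fdia (a ⋆) (fdia (a ⋆) p) ≤ₜ fdia (a ⋆) p
  fdia-⋆-idem a p = subst (_≤ ⌜ fdia (a ⋆) p ⌝) (fdia-comp (a ⋆) (a ⋆) p) (fdia-monoᵉ p (⋆-trans a))

  bdia-⋆-idem : ∀ b p → bdia (b ⋆) (bdia (b ⋆) p) ≤ₜ bdia (b ⋆) p
  bdia-⋆-idem b p = subst (_≤ ⌜ bdia (b ⋆) p ⌝) (bdia-comp (b ⋆) (b ⋆) p) (bdia-monoᵉ p (⋆-trans b))

  fdia-⋆-unfold : ∀ a p → (fdia (a ⋆) p ⊓ ∁ p) ≤ₜ fdia a (fdia (a ⋆) p)
  fdia-⋆-unfold a p = below-test W (test-≤𝟙 (F ⊓ ∁ p))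
    (subst (λ z → neg W · z ≤ 𝟘) (test-comm (∁ p) F)
      (null-assocʳ (fdia-null (∁ W ⊓ ∁ p) (a ⋆) p (⋆-null (neg W · neg p) a ⌜ p ⌝ zero-steps more-steps))))
    where
    F = fdia (a ⋆) p
    W = fdia a F
    zero-steps : neg W · neg p · ⌜ p ⌝ ≤ 𝟘
    zero-steps = null-assocˡ (null-·ʳ (neg W) (≤-reflexive (neg-·-test p)))
    more-steps : neg W · neg p · (a · a ⋆) · ⌜ p ⌝ ≤ 𝟘
    more-steps = ≤-trans (·-monoʳ ⌜ p ⌝ (·-monoʳ (a · a ⋆) (·-decreasingʳ (neg W) (neg-≤𝟙 p))))
      (subst (_≤ 𝟘) (cong (_· ⌜ p ⌝) (·-assoc (neg W) a (a ⋆)))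
        (fdia-null⁻ (neg W · a) (a ⋆) p (fdia-unit a F)))

  bdia-⋆-induct : ∀ b s t → s ≤ₜ t → bdia (b · b ⋆) s ≤ₜ t → bdia (b ⋆) s ≤ₜ t
  bdia-⋆-induct b s t s≤t step = bdia-intro (b ⋆) s t
    (⋆-null ⌜ s ⌝ b (neg t) (≤-trans (·-monoʳ (neg t) s≤t) (≤-reflexive (test-·-neg t)))
      (bdia-elim (b · b ⋆) s t step))

  bdia-cases : ∀ a s r t → bdia a (s ⊓ r) ≤ₜ t → bdia a (s ⊓ ∁ r) ≤ₜ t → bdia a s ≤ₜ t
  bdia-cases a s r t on-r off-r = bdia-intro a s t (null-assocˡ (split-null r ⌜ s ⌝ (a · neg t)
    (null-assocʳ (bdia-elim a (s ⊓ r) t on-r))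
    (null-assocʳ (bdia-elim a (s ⊓ ∁ r) t off-r))))

module DCommutation {c : Level} (S : ModalKleeneAlgebra c) (a b : ModalKleeneAlgebra.Carrier S)
                    (loc : LocallyDCommute S a b) where
  open ModalKleeneAlgebra S
  open DiamondFacts S
  open PosetReasoning ≤-poset

  A B : Carrier
  A = a ⋆
  B = b ⋆

  Admissible : Test → Set c
  Admissible q = ∀ p → bdia B (q ⊓ fdia A p) ≤ₜ fdia A (bdia B p)

  -- By conjugation, q is admissible iff
  -- q ≤ ¬(|A⟩p ⊓ |B⟩¬|A⟩⟨B|p) for all p, a condition preserved by joins.
  admissible-join : ∀ r → (∀ u → (∀ q → Admissible q → q ≤ₜ u) → r ≤ₜ u) → Admissible r
  admissible-join r r-least p = bdia-conj-intro B (r ⊓ F) T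
    (null-assocˡ (≤-trans (·-monoʳ ⌜ F ⊓ H ⌝ (r-least (∁ (F ⊓ H)) admissible-below))
                          (≤-reflexive (neg-·-test (F ⊓ H)))))
    where
    F T H : Test
    F = fdia A p
    T = fdia A (bdia B p)
    H = fdia B (∁ T)
    admissible-below : ∀ q → Admissible q → q ≤ₜ ∁ (F ⊓ H)
    admissible-below q adm = below-test (∁ (F ⊓ H)) (test-≤𝟙 q)
      (subst (_≤ 𝟘) (trans (·-assoc ⌜ q ⌝ ⌜ F ⌝ ⌜ H ⌝) (test-comm q (F ⊓ H)))
        (bdia-conj-elim B (q ⊓ F) T (adm p)))

  admissible-step : ∀ q r → Admissible r →
    ⌜ q ⌝ · a · neg r ≤ 𝟘 → ⌜ q ⌝ · b · neg r ≤ 𝟘 → Admissible q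
  admissible-step q r r-admissible qa¬r≤0 qb¬r≤0 p =
    bdia-⋆-induct b (q ⊓ F) T no-step (bdia-cases (b · B) (q ⊓ F) p T inside-p outside-p)
    where
    F T W : Test
    F = fdia A p
    T = fdia A (bdia B p)
    W = fdia a F

    -- With no b-step we stay in |A⟩p ≤ |A⟩⟨B|p.
    no-step : (q ⊓ F) ≤ₜ T
    no-step = ≤-trans (⊓-lowerʳ q F) (fdia-mono A (bdia-⋆-inflate b p))

    -- Starting inside p, b-steps end in ⟨B|p ≤ |A⟩⟨B|p.
    inside-p : bdia (b · B) (q ⊓ F ⊓ p) ≤ₜ T
    inside-p = begin
      ⌜ bdia (b · B) (q ⊓ F ⊓ p) ⌝  ≤⟨ bdia-mono (b · B) (⊓-lowerʳ (q ⊓ F) p) ⟩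
      ⌜ bdia (b · B) p ⌝            ≤⟨ bdia-monoᵉ p (⋆-step b) ⟩
      ⌜ bdia B p ⌝                  ≤⟨ fdia-⋆-inflate a (bdia B p) ⟩
      ⌜ T ⌝                         ∎

    -- One b-step from q ⊓ |a⟩F ends in r (hypothesis on q) and in T (local
    -- d-commutation, then admissibility of r on the a-successors).
    b-step : bdia b (q ⊓ W) ≤ₜ (r ⊓ T)
    b-step = ⊓-greatest (bdia b (q ⊓ W)) into-r into-T
      where
      into-r : bdia b (q ⊓ W) ≤ₜ r
      into-r = ≤-trans (bdia-mono b (⊓-lowerˡ q W)) (bdia-intro b q r qb¬r≤0)
      into-T : bdia b (q ⊓ W) ≤ₜ T
      into-T = begin
        ⌜ bdia b (q ⊓ W) ⌝             ≤⟨ bdia-mono b (fdia-guard q a r F qa¬r≤0) ⟩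
        ⌜ bdia b (fdia a (r ⊓ F)) ⌝    ≤⟨ loc (r ⊓ F) ⟩
        ⌜ fdia A (bdia B (r ⊓ F)) ⌝    ≤⟨ fdia-mono A (r-admissible p) ⟩
        ⌜ fdia A T ⌝                   ≤⟨ fdia-⋆-idem a (bdia B p) ⟩
        ⌜ T ⌝                          ∎

    -- Starting outside p, the state is in |a⟩F, so the first b-step ends in
    -- r ⊓ T, where admissibility of r bounds the remaining b-steps.
    outside-p : bdia (b · B) (q ⊓ F ⊓ ∁ p) ≤ₜ T
    outside-p = begin
      ⌜ bdia (b · B) (q ⊓ F ⊓ ∁ p) ⌝   ≤⟨ bdia-mono (b · B) (q⊓F⊓¬p≤q⊓W) ⟩
      ⌜ bdia (b · B) (q ⊓ W) ⌝         ≡⟨ bdia-comp b B (q ⊓ W) ⟩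
      ⌜ bdia B (bdia b (q ⊓ W)) ⌝      ≤⟨ bdia-mono B b-step ⟩
      ⌜ bdia B (r ⊓ T) ⌝               ≤⟨ r-admissible (bdia B p) ⟩
      ⌜ fdia A (bdia B (bdia B p)) ⌝   ≤⟨ fdia-mono A (bdia-⋆-idem b p) ⟩
      ⌜ T ⌝                            ∎
      where
      q⊓F⊓¬p≤q⊓W : (q ⊓ F ⊓ ∁ p) ≤ₜ (q ⊓ W)
      q⊓F⊓¬p≤q⊓W = subst (_≤ ⌜ q ⊓ W ⌝) (sym (·-assoc ⌜ q ⌝ ⌜ F ⌝ (neg p)))
        (·-monoˡ ⌜ q ⌝ (fdia-⋆-unfold a p))

  admissible-full : ∀ r → neg r ≤ 𝟘 → Admissible r → DCommute S a b
  admissible-full r ¬r≤0 r-admissible p =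
    ≤-trans (bdia-mono B (⊓-greatest F F≤r ≤-refl)) (r-admissible p)
    where
    F : Test
    F = fdia A p
    F≤r : F ≤ₜ r
    F≤r = below-test r (test-≤𝟙 F) (null-·ˡ ⌜ F ⌝ ¬r≤0)

-- Step (3): the join R of all admissible tests is admissible; so is
-- Q = ¬|a+b⟩¬R by step (2), whence Q ≤ R, i.e. ¬R - |a+b⟩¬R ≤ 0, and
-- Noetherianity of a+b gives ¬R = 0.
theorem11p2 : ∀ {c : Level} (S : ModalKleeneAlgebra c) → TestsComplete S →
    ∀ a b → Noetherian S (ModalKleeneAlgebra._+_ S a b) →
    LocallyDCommute S a b → DCommute S a b
theorem11p2 S complete a b noetherian loc = admissible-full R ¬R-null R-admissible
  where
  open ModalKleeneAlgebra S
  open DiamondFacts S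
  open DCommutation S a b loc

  R Q : Test
  R = proj₁ (complete Admissible)
  Q = ∁ (fdia (a + b) (∁ R))

  R-admissible : Admissible R
  R-admissible = admissible-join R (proj₂ (proj₂ (complete Admissible)))

  Q≤R : Q ≤ₜ R
  Q≤R = proj₁ (proj₂ (complete Admissible)) Q
    (admissible-step Q R R-admissible (fdia-summand (∁ R) +-ub₁) (fdia-summand (∁ R) +-ub₂))

  ¬R-null : neg R ≤ 𝟘
  ¬R-null = noetherian (∁ R) (≤-trans (·-monoˡ (neg R) Q≤R) (≤-reflexive (neg-·-test R)))
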